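{- Let $d\ge 6$ be an integer that is a multiple of $3$, and let $B$ be a binary string of length $d$. Then $B$ contains as a (contiguous) substring either $d/3$ consecutive $0$s, or $d/3$ consecutive $1$s, or one of the strings $0101$, $001$, $011$. -}

module Defs where

open import Data.Bool using (Bool; true; false)
open import Data.List using (List; []; _∷_; _++_; replicate)
open import Data.Product using (∃₂)
open import Relation.Binary.PropositionalEquality using (_≡_)

-- Binary strings: lists of bits, with false = 0 and true = 1.
BinString : Set
BinString = List Bool

_isSubstringOf_ : BinString → BinString → Set
s isSubstringOf B = ∃₂ λ u v → B ≡ u ++ (s ++ v)

s0101 s001 s011 : BinString
s0101 = false ∷ true ∷ false ∷ true ∷ []
s001  = false ∷ false ∷ true ∷ []
s011  = false ∷ true ∷ true ∷ []

{-# OPTIONS --safe #-}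
-- Avoiding 001 and 011, a string has the form 1ᵃ(01)ʲ0ᵇ; avoiding 0101 as well
-- forces j ≤ 1, so its length is at most a + b + 2. If a, b < k, this is at most
-- 2k < 3k.
module Submission where

open import Defs
open import Data.Bool using (Bool; true; false)
open import Data.Nat using (ℕ; zero; suc; _+_; _*_; _∸_; _≤_; _<_; z≤n; s≤s; _≤?_)
open import Data.Nat.Properties
  using ( ≤-refl; ≤-reflexive; <-≤-trans; n<1+n; <⇒≱; ≰⇒>; +-suc; +-identityʳ
        ; +-mono-≤; +-monoʳ-≤; +-monoˡ-≤; *-monoˡ-<; module ≤-Reasoning)
open import Data.List using ([]; _∷_; _++_; length; replicate)
open import Data.List.Properties using (++-assoc; ++-identityʳ; length-++; length-replicate)
open import Data.Product using (∃; _,_)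
open import Data.Sum using (_⊎_; inj₁; inj₂; map)
open import Relation.Nullary using (yes; no; contradiction)
open import Relation.Binary.PropositionalEquality using (_≡_; refl; cong; cong₂; sym; module ≡-Reasoning)

isSubstringOf-prefix : ∀ s v → s isSubstringOf (s ++ v)
isSubstringOf-prefix s v = [] , v , refl

isSubstringOf-suffix : ∀ s u → s isSubstringOf (u ++ s)
isSubstringOf-suffix s u = u , [] , cong (u ++_) (sym (++-identityʳ s))

isSubstringOf-trans : ∀ {r s t} → r isSubstringOf s → s isSubstringOf t → r isSubstringOf t
isSubstringOf-trans {r} (u , v , refl) (u′ , v′ , refl) = u′ ++ u , v ++ v′ , (begin
  u′ ++ ((u ++ (r ++ v)) ++ v′)  ≡⟨ cong (u′ ++_) (++-assoc u (r ++ v) v′) ⟩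
  u′ ++ (u ++ ((r ++ v) ++ v′))  ≡⟨ cong (λ w → u′ ++ (u ++ w)) (++-assoc r v v′) ⟩
  u′ ++ (u ++ (r ++ (v ++ v′)))  ≡⟨ ++-assoc u′ u (r ++ (v ++ v′)) ⟨
  (u′ ++ u) ++ (r ++ (v ++ v′))  ∎)
  where open ≡-Reasoning

replicate-split : ∀ {A : Set} {k a} (x : A) → k ≤ a → replicate a x ≡ replicate k x ++ replicate (a ∸ k) x
replicate-split x z≤n     = refl
replicate-split x (s≤s p) = cong (x ∷_) (replicate-split x p)

replicate-isSubstringOf : ∀ {k a} (x : Bool) → k ≤ a → replicate k x isSubstringOf replicate a x
replicate-isSubstringOf x k≤a = [] , _ , replicate-split x k≤a

ContainsForbidden : BinString → Set
ContainsForbidden B = (s0101 isSubstringOf B) ⊎ (s001 isSubstringOf B) ⊎ (s011 isSubstringOf B)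

containsForbidden-mono : ∀ {B C} → B isSubstringOf C → ContainsForbidden B → ContainsForbidden C
containsForbidden-mono B⊑C = map (λ p → isSubstringOf-trans p B⊑C)
                                 (map (λ p → isSubstringOf-trans p B⊑C) (λ p → isSubstringOf-trans p B⊑C))

record OnesThenZeros (B : BinString) : Set where
  constructor onesThenZeros
  field
    ones   : ℕ
    middle : BinString
    zeros  : ℕ
    middle-short : length middle ≤ 2
    split  : B ≡ replicate ones true ++ (middle ++ replicate zeros false)

allFalse⊎001 : ∀ B → (∃ λ b → B ≡ replicate b false) ⊎ (s001 isSubstringOf (false ∷ false ∷ B))
allFalse⊎001 []          = inj₁ (0 , refl)
allFalse⊎001 (true ∷ B)  = inj₂ ([] , B , refl)
allFalse⊎001 (false ∷ B) with allFalse⊎001 B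
... | inj₁ (b , refl) = inj₁ (suc b , refl)
... | inj₂ p          = inj₂ (isSubstringOf-trans p (isSubstringOf-suffix _ (false ∷ [])))

containsForbidden⊎onesThenZeros : ∀ B → ContainsForbidden B ⊎ OnesThenZeros B
containsForbidden⊎onesThenZeros [] = inj₂ (onesThenZeros 0 [] 0 z≤n refl)
containsForbidden⊎onesThenZeros (true ∷ B) with containsForbidden⊎onesThenZeros B
... | inj₁ p = inj₁ (containsForbidden-mono (isSubstringOf-suffix B (true ∷ [])) p)
... | inj₂ (onesThenZeros a m b m≤2 refl) = inj₂ (onesThenZeros (suc a) m b m≤2 refl)
containsForbidden⊎onesThenZeros (false ∷ []) = inj₂ (onesThenZeros 0 [] 1 z≤n refl)
containsForbidden⊎onesThenZeros (false ∷ false ∷ B) with allFalse⊎001 B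
... | inj₁ (b , refl) = inj₂ (onesThenZeros 0 [] (suc (suc b)) z≤n refl)
... | inj₂ p         = inj₁ (inj₂ (inj₁ p))
containsForbidden⊎onesThenZeros (false ∷ true ∷ []) =
  inj₂ (onesThenZeros 0 (false ∷ true ∷ []) 0 ≤-refl refl)
containsForbidden⊎onesThenZeros (false ∷ true ∷ true ∷ B) = inj₁ (inj₂ (inj₂ ([] , B , refl)))
containsForbidden⊎onesThenZeros (false ∷ true ∷ false ∷ []) =
  inj₂ (onesThenZeros 0 (false ∷ true ∷ []) 1 ≤-refl refl)
containsForbidden⊎onesThenZeros (false ∷ true ∷ false ∷ true ∷ B) = inj₁ (inj₁ ([] , B , refl))
containsForbidden⊎onesThenZeros (false ∷ true ∷ false ∷ false ∷ B) with allFalse⊎001 B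
... | inj₁ (b , refl) = inj₂ (onesThenZeros 0 (false ∷ true ∷ []) (suc (suc b)) ≤-refl refl)
... | inj₂ p         = inj₁ (inj₂ (inj₁ (isSubstringOf-trans p (isSubstringOf-suffix _ (false ∷ true ∷ [])))))

onesThenZeros-length : ∀ {B} (O : OnesThenZeros B) →
  length B ≤ suc (OnesThenZeros.ones O) + suc (OnesThenZeros.zeros O)
onesThenZeros-length (onesThenZeros a m b m≤2 refl) = begin
  length (replicate a true ++ (m ++ replicate b false))  ≡⟨ length-++ (replicate a true) ⟩
  length (replicate a true) + length (m ++ replicate b false)
    ≡⟨ cong₂ _+_ (length-replicate a) (length-++ m) ⟩
  a + (length m + length (replicate b false))             ≡⟨ cong (λ n → a + (length m + n)) (length-replicate b) ⟩
  a + (length m + b)                                      ≤⟨ +-monoʳ-≤ a (+-monoˡ-≤ b m≤2) ⟩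
  a + suc (suc b)                                         ≡⟨ +-suc a (suc b) ⟩
  suc a + suc b                                           ∎
  where open ≤-Reasoning

long-onesThenZeros : ∀ {k B} → OnesThenZeros B → 2 * k < length B →
  (replicate k true isSubstringOf B) ⊎ (replicate k false isSubstringOf B)
long-onesThenZeros {k} O@(onesThenZeros a m b _ refl) long with k ≤? a | k ≤? b
... | yes k≤a | _ = inj₁ (isSubstringOf-trans (replicate-isSubstringOf true k≤a) (isSubstringOf-prefix _ _))
... | no _ | yes k≤b = inj₂ (isSubstringOf-trans (replicate-isSubstringOf false k≤b)
                               (isSubstringOf-trans (isSubstringOf-suffix _ m) (isSubstringOf-suffix _ (replicate a true))))
... | no k≰a | no k≰b = contradiction short (<⇒≱ long)
  where
  open ≤-Reasoning
  short : length (replicate a true ++ (m ++ replicate b false)) ≤ 2 * k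
  short = begin
    length (replicate a true ++ (m ++ replicate b false)) ≤⟨ onesThenZeros-length O ⟩
    suc a + suc b                                         ≤⟨ +-mono-≤ (≰⇒> k≰a) (≰⇒> k≰b) ⟩
    k + k                                                 ≡⟨ cong (k +_) (+-identityʳ k) ⟨
    2 * k                                                 ∎

lemma7 : (k : ℕ) → 6 ≤ 3 * k → (B : BinString) → length B ≡ 3 * k →
    (replicate k false isSubstringOf B) ⊎ (replicate k true isSubstringOf B) ⊎
    (s0101 isSubstringOf B) ⊎ (s001 isSubstringOf B) ⊎ (s011 isSubstringOf B)
lemma7 zero () _ _
lemma7 k@(suc _) _ B len with containsForbidden⊎onesThenZeros B
... | inj₁ forbidden = inj₂ (inj₂ forbidden)
... | inj₂ O with long-onesThenZeros O (<-≤-trans (*-monoˡ-< k (n<1+n 2)) (≤-reflexive (sym len)))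
...   | inj₁ ones  = inj₂ (inj₁ ones)
...   | inj₂ zeros = inj₁ zeros
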